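{- Let $0<\delta\le 1$ and let $r$ be a fixed positive integer independent of $N$. Let $X_1,X_2,\ldots,X_N\subseteq [N]$ satisfy $|X_i|\geq \delta N$ for all $i$. If $N$ is sufficiently large, then with $s=\lceil \log_2 r\rceil$ there exists a set $I\subseteq [N]$ with $|I|=r$ such that $\left|\bigcap_{i\in I}X_i\right| \geq \delta_s N/(2r)$, where $\delta_0=\delta$ and $\delta_{i+1}=\delta_i^2/4$ for $i\ge 0$.
   Context: $[N]=\{1,2,\ldots,N\}$.
   Formalization: The parameter δ ranges over the rationals in the interval from 0 to 1. -}

module Defs where

open import Data.Nat as ℕ using (ℕ; zero; suc)
open import Data.Integer using (+_)
open import Data.Rational using (ℚ; _/_; _*_)
open import Data.Bool using (Bool; true; false; _∨_; not)
open import Data.Vec using (Vec; tabulate; lookup; foldr)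
open import Data.Fin using (Fin)
open import Data.Fin.Subset using (Subset)

ℕ→ℚ : ℕ → ℚ
ℕ→ℚ n = + n / 1

δseq : ℚ → ℕ → ℚ
δseq δ zero = δ
δseq δ (suc i) = (δseq δ i * δseq δ i) * (+ 1 / 4)

bigcap : ∀ {M N} → Subset M → (Fin M → Subset N) → Subset N
bigcap {M} I X = tabulate λ x →
  foldr (λ _ → Bool) (λ b acc → Data.Bool._∧_ b acc) true
    (tabulate λ i → not (lookup I i) ∨ lookup (X i) x)

{-# OPTIONS --safe #-}
-- Let d(x) be the number of sets X_i containing x and a(x) = d(x) ∸ r. For a set C of at most
-- r indices, every x lies in at least a(x) sets X_i with i ∉ C, so the moment
-- Φ(C, k) = Σ_{x ∈ ⋂_C X} a(x)^k satisfies Φ(C, k+1) ≤ Σ_{i ∉ C} Φ(C ∪ {i}, k). Adding the best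
-- index i and iterating r times from C = ∅ gives |C| = r and Σ_x a(x)^r ≤ N^r |⋂_C X|.
-- Since Σ_x a(x) ≥ Σ_i |X_i| − rN ≥ δN²/2 for N ≥ 2r/δ, the power-mean inequality
-- (Σ a)^r ≤ N^(r-1) Σ a^r yields |⋂_C X| ≥ (δ/2)^r N. Finally δ_s = 4 (δ/4)^(2^s) with
-- 2^s ≥ r and δ ≤ 1, so δ_s ≤ 2r (δ/2)^r.
module Submission where

open import Defs using (ℕ→ℚ; δseq; bigcap)

module Counting where
  open import Algebra.Properties.CommutativeSemigroup using (x∙yz≈y∙xz)
  open import Data.Bool using (Bool; true; false; _∧_; _∨_; not)
  open import Data.Bool.Properties using (∧-comm; ∧-assoc)
  open import Data.Fin using (Fin; zero; suc)
  open import Data.Fin.Subset using (Subset; ∣_∣; ⊥)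
  open import Data.Fin.Subset.Properties using (∣⊥∣≡0)
  open import Data.Nat
    using (ℕ; zero; suc; _+_; _*_; _^_; _∸_; _≤_; _<_; z≤n; s≤s; z<s; NonZero; ⌊_/2⌋; ⌈_/2⌉)
  open import Data.Nat.Induction using (<-wellFounded)
  open import Data.Nat.Logarithm using (⌈log₂_⌉)
  open import Data.Nat.Logarithm.Core using (⌈log2⌉)
  open import Data.Nat.Properties
  open import Data.Nat.Tactic.RingSolver using (solve-∀)
  open import Algebra.Properties.Semiring.Sum +-*-semiring
    using (sum; sum-syntax; sum-cong-≗; ∑-comm; ∑-distrib-+; *-distribˡ-sum; *-distribʳ-sum)
  open import Data.Product using (∃; _×_; _,_)
  open import Data.Sum using (inj₁; inj₂)
  open import Data.Vec using (_∷_; []; lookup; _[_]≔_)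
  open import Data.Vec.Properties using (lookup∘tabulate)
  open import Induction.WellFounded using (Acc; acc)
  open import Relation.Binary using (_Preserves_⟶_)
  open import Relation.Binary.PropositionalEquality
  open import Relation.Nullary using (yes; no)

  -- Finite sums and the power-mean inequality

  ∑-mono-≤ : ∀ {n} {f g : Fin n → ℕ} → (∀ i → f i ≤ g i) → sum f ≤ sum g
  ∑-mono-≤ {zero}  f≤g = z≤n
  ∑-mono-≤ {suc n} f≤g = +-mono-≤ (f≤g zero) (∑-mono-≤ (λ i → f≤g (suc i)))

  ∑-const : ∀ n c → ∑[ i < n ] c ≡ n * c
  ∑-const zero    c = refl
  ∑-const (suc n) c = cong (c +_) (∑-const n c)

  ∑≤n*max : ∀ {n} (f : Fin (suc n) → ℕ) → ∃ λ i → sum f ≤ suc n * f i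
  ∑≤n*max {zero}  f = zero , ≤-refl
  ∑≤n*max {suc n} f with ∑≤n*max (λ i → f (suc i))
  ... | j , tail≤ with f zero ≤? f (suc j)
  ...   | yes f₀≤fⱼ = suc j , +-mono-≤ f₀≤fⱼ tail≤
  ...   | no  f₀≰fⱼ = zero , +-monoʳ-≤ (f zero) (≤-trans tail≤ (*-monoʳ-≤ (suc n) (<⇒≤ (≰⇒> f₀≰fⱼ))))

  ∑∑-distrib-+ : ∀ {m n} (f g : Fin m → Fin n → ℕ) →
    ∑[ i < m ] ∑[ j < n ] (f i j + g i j) ≡
    ∑[ i < m ] ∑[ j < n ] f i j + ∑[ i < m ] ∑[ j < n ] g i j
  ∑∑-distrib-+ {n = n} f g = trans (sum-cong-≗ (λ i → ∑-distrib-+ (f i) (g i)))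
    (∑-distrib-+ (λ i → ∑[ j < n ] f i j) (λ i → ∑[ j < n ] g i j))

  *-distrib-∑∑ : ∀ {m n} (a : Fin m → ℕ) (b : Fin n → ℕ) →
    sum a * sum b ≡ ∑[ i < m ] ∑[ j < n ] (a i * b j)
  *-distrib-∑∑ a b = trans (*-distribʳ-sum (sum b) a) (sum-cong-≗ (λ i → *-distribˡ-sum (a i) b))

  *-^-distrib : ∀ m n o → (m * n) ^ o ≡ m ^ o * n ^ o
  *-^-distrib m n zero    = refl
  *-^-distrib m n (suc o) = trans (cong (m * n *_) (*-^-distrib m n o)) (interchange m n _ _)
    where
    interchange : ∀ a b c d → a * b * (c * d) ≡ a * c * (b * d)
    interchange = solve-∀

  rearrangement-≤ : ∀ {f} → f Preserves _≤_ ⟶ _≤_ →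
    ∀ {a b} → a ≤ b → a * f b + b * f a ≤ a * f a + b * f b
  rearrangement-≤ {f} f-mono {a} a≤b with m≤n⇒∃[o]m+o≡n a≤b
  ... | c , refl = begin
    a * f (a + c) + (a + c) * f a             ≡⟨ regroup a c (f (a + c)) (f a) ⟩
    a * f a + (a * f (a + c) + c * f a)       ≤⟨ +-monoʳ-≤ (a * f a) (+-monoʳ-≤ (a * f (a + c))
                                                   (*-monoʳ-≤ c (f-mono (m≤m+n a c)))) ⟩
    a * f a + (a * f (a + c) + c * f (a + c)) ≡⟨ cong (a * f a +_) (*-distribʳ-+ (f (a + c)) a c) ⟨
    a * f a + (a + c) * f (a + c)             ∎
    where
    open ≤-Reasoning
    regroup : ∀ a c x y → a * x + (a + c) * y ≡ a * y + (a * x + c * y)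
    regroup = solve-∀

  rearrangement : ∀ {f} → f Preserves _≤_ ⟶ _≤_ → ∀ a b → a * f b + b * f a ≤ a * f a + b * f b
  rearrangement {f} f-mono a b with ≤-total a b
  ... | inj₁ a≤b = rearrangement-≤ f-mono a≤b
  ... | inj₂ b≤a =
    subst₂ _≤_ (+-comm (b * f a) (a * f b)) (+-comm (b * f b) (a * f a)) (rearrangement-≤ f-mono b≤a)

  chebyshev : ∀ {n} (a b : Fin n → ℕ) →
    (∀ i j → a i * b j + a j * b i ≤ a i * b i + a j * b j) →
    sum a * sum b ≤ n * ∑[ i < n ] (a i * b i)
  chebyshev {n} a b similarly-ordered = *-cancelˡ-≤ 2 (begin
    2 * (sum a * sum b)                    ≡⟨ cong (2 *_) (*-distrib-∑∑ a b) ⟩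
    2 * ∑∑ (λ i j → a i * b j)             ≡⟨ cong (∑∑ (λ i j → a i * b j) +_) (+-identityʳ _) ⟩
    ∑∑ (λ i j → a i * b j) + ∑∑ (λ i j → a i * b j)
                                           ≡⟨ cong (∑∑ (λ i j → a i * b j) +_) (∑-comm (λ i j → a i * b j)) ⟩
    ∑∑ (λ i j → a i * b j) + ∑∑ (λ i j → a j * b i)
                                           ≡⟨ ∑∑-distrib-+ (λ i j → a i * b j) (λ i j → a j * b i) ⟨
    ∑∑ (λ i j → a i * b j + a j * b i)     ≤⟨ ∑-mono-≤ (λ i → ∑-mono-≤ (similarly-ordered i)) ⟩
    ∑∑ (λ i j → a i * b i + a j * b j)     ≡⟨ ∑∑-distrib-+ (λ i j → a i * b i) (λ i j → a j * b j) ⟩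
    ∑∑ (λ i j → a i * b i) + ∑∑ (λ i j → a j * b j)
                                           ≡⟨ cong₂ _+_ diagonal (∑-const n T) ⟩
    n * T + n * T                          ≡⟨ cong (n * T +_) (+-identityʳ (n * T)) ⟨
    2 * (n * T)                            ∎)
    where
    open ≤-Reasoning
    ∑∑ : (Fin n → Fin n → ℕ) → ℕ
    ∑∑ h = ∑[ i < n ] ∑[ j < n ] h i j
    T : ℕ
    T = ∑[ i < n ] (a i * b i)
    diagonal : ∑∑ (λ i j → a i * b i) ≡ n * T
    diagonal = trans (sum-cong-≗ (λ i → ∑-const n (a i * b i))) (sym (*-distribˡ-sum n (λ i → a i * b i)))

  power-mean : ∀ {n} (a : Fin n → ℕ) r → sum a ^ r * n ≤ n ^ r * ∑[ i < n ] (a i ^ r)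
  power-mean {n} a zero    = ≤-reflexive (cong (_+ 0) (sym (trans (∑-const n 1) (*-identityʳ n))))
  power-mean {n} a (suc r) = begin
    sum a * sum a ^ r * n                  ≡⟨ *-assoc (sum a) _ n ⟩
    sum a * (sum a ^ r * n)                ≤⟨ *-monoʳ-≤ (sum a) (power-mean a r) ⟩
    sum a * (n ^ r * ∑[ i < n ] (a i ^ r)) ≡⟨ x∙yz≈y∙xz *-commutativeSemigroup (sum a) (n ^ r) _ ⟩
    n ^ r * (sum a * ∑[ i < n ] (a i ^ r)) ≤⟨ *-monoʳ-≤ (n ^ r) (chebyshev a (λ i → a i ^ r)
                                                (λ i j → rearrangement (^-monoˡ-≤ r) (a i) (a j))) ⟩
    n ^ r * (n * ∑[ i < n ] (a i ^ suc r)) ≡⟨ *-assoc (n ^ r) n _ ⟨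
    n ^ r * n * ∑[ i < n ] (a i ^ suc r)   ≡⟨ cong (_* ∑[ i < n ] (a i ^ suc r)) (*-comm (n ^ r) n) ⟩
    n ^ suc r * ∑[ i < n ] (a i ^ suc r)   ∎
    where open ≤-Reasoning

  -- Subsets and common intersections

  χ : Bool → ℕ
  χ false = 0
  χ true  = 1

  χ-∧ : ∀ b c → χ (b ∧ c) ≡ χ b * χ c
  χ-∧ false c = refl
  χ-∧ true  c = sym (+-identityʳ (χ c))

  ∣p∣≡∑χ : ∀ {n} (p : Subset n) → ∣ p ∣ ≡ ∑[ i < n ] χ (lookup p i)
  ∣p∣≡∑χ []          = refl
  ∣p∣≡∑χ (false ∷ p) = ∣p∣≡∑χ p
  ∣p∣≡∑χ (true  ∷ p) = cong suc (∣p∣≡∑χ p)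

  ∣p[i]≔true∣≡1+∣p∣ : ∀ {n} (p : Subset n) i → lookup p i ≡ false → ∣ p [ i ]≔ true ∣ ≡ suc ∣ p ∣
  ∣p[i]≔true∣≡1+∣p∣ (false ∷ p) zero    _  = refl
  ∣p[i]≔true∣≡1+∣p∣ (false ∷ p) (suc i) pᵢ = ∣p[i]≔true∣≡1+∣p∣ p i pᵢ
  ∣p[i]≔true∣≡1+∣p∣ (true  ∷ p) (suc i) pᵢ = cong suc (∣p[i]≔true∣≡1+∣p∣ p i pᵢ)

  ∣p∣<n⇒∃∉ : ∀ {n} (p : Subset n) → ∣ p ∣ < n → ∃ λ i → lookup p i ≡ false
  ∣p∣<n⇒∃∉ (false ∷ p) _           = zero , refl
  ∣p∣<n⇒∃∉ (true  ∷ p) (s≤s ∣p∣<n) with ∣p∣<n⇒∃∉ p ∣p∣<n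
  ... | i , pᵢ = suc i , pᵢ

  pigeonhole : ∀ {n} (c : Fin n → Bool) (f : Fin n → ℕ) → (∃ λ i → c i ≡ false) →
    ∃ λ i → c i ≡ false × ∑[ j < n ] (χ (not (c j)) * f j) ≤ n * f i
  pigeonhole {suc n} c f (i₀ , cᵢ₀) with ∑≤n*max (λ j → χ (not (c j)) * f j)
  ... | i , bound with c i in cᵢ
  ...   | false = i , cᵢ , subst (λ t → ∑[ j < suc n ] (χ (not (c j)) * f j) ≤ suc n * t)
                                 (+-identityʳ (f i)) bound
  ...   | true  = i₀ , cᵢ₀ , ≤-trans bound (≤-trans (≤-reflexive (*-zeroʳ (suc n))) z≤n)

  lookup-bigcap-∷ : ∀ {M N} b (I : Subset M) (X : Fin (suc M) → Subset N) x →
    lookup (bigcap (b ∷ I) X) x ≡ (not b ∨ lookup (X zero) x) ∧ lookup (bigcap I (λ i → X (suc i))) x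
  lookup-bigcap-∷ b I X x =
    trans (lookup∘tabulate _ x) (cong ((not b ∨ lookup (X zero) x) ∧_) (sym (lookup∘tabulate _ x)))

  lookup-bigcap-⊥ : ∀ {M N} (X : Fin M → Subset N) x → lookup (bigcap ⊥ X) x ≡ true
  lookup-bigcap-⊥ {zero}  X x = lookup∘tabulate _ x
  lookup-bigcap-⊥ {suc M} X x =
    trans (lookup-bigcap-∷ false ⊥ X x) (lookup-bigcap-⊥ (λ i → X (suc i)) x)

  lookup-bigcap-insert : ∀ {M N} (C : Subset M) (X : Fin M → Subset N) i x → lookup C i ≡ false →
    lookup (bigcap (C [ i ]≔ true) X) x ≡ lookup (bigcap C X) x ∧ lookup (X i) x
  lookup-bigcap-insert (false ∷ C) X zero x _ = begin
    lookup (bigcap (true ∷ C) X) x                      ≡⟨ lookup-bigcap-∷ true C X x ⟩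
    lookup (X zero) x ∧ ⋂C                              ≡⟨ ∧-comm (lookup (X zero) x) ⋂C ⟩
    ⋂C ∧ lookup (X zero) x                              ≡⟨ cong (_∧ lookup (X zero) x)
                                                             (lookup-bigcap-∷ false C X x) ⟨
    lookup (bigcap (false ∷ C) X) x ∧ lookup (X zero) x ∎
    where
    open ≡-Reasoning
    ⋂C = lookup (bigcap C (λ i → X (suc i))) x
  lookup-bigcap-insert (b ∷ C) X (suc i) x Cᵢ = begin
    lookup (bigcap (b ∷ C [ i ]≔ true) X) x         ≡⟨ lookup-bigcap-∷ b (C [ i ]≔ true) X x ⟩
    X₀ ∧ lookup (bigcap (C [ i ]≔ true) X′) x       ≡⟨ cong (X₀ ∧_) (lookup-bigcap-insert C X′ i x Cᵢ) ⟩
    X₀ ∧ (lookup (bigcap C X′) x ∧ lookup (X′ i) x) ≡⟨ ∧-assoc X₀ _ _ ⟨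
    (X₀ ∧ lookup (bigcap C X′) x) ∧ lookup (X′ i) x ≡⟨ cong (_∧ lookup (X′ i) x) (lookup-bigcap-∷ b C X x) ⟨
    lookup (bigcap (b ∷ C) X) x ∧ lookup (X′ i) x   ∎
    where
    open ≡-Reasoning
    X′ = λ i → X (suc i)
    X₀ = not b ∨ lookup (X zero) x

  module Greedy {M N : ℕ} (X : Fin M → Subset N) (r : ℕ) where

    inAll : Subset M → Fin N → Bool
    inAll C x = lookup (bigcap C X) x

    freshCover : Subset M → Fin M → Fin N → Bool
    freshCover C i x = not (lookup C i) ∧ lookup (X i) x

    degree : Fin N → ℕ
    degree x = ∑[ i < M ] χ (lookup (X i) x)

    freshDegree : Subset M → Fin N → ℕ
    freshDegree C x = ∑[ i < M ] χ (freshCover C i x)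

    excess : Fin N → ℕ
    excess x = degree x ∸ r

    moment : Subset M → ℕ → ℕ
    moment C k = ∑[ x < N ] (χ (inAll C x) * excess x ^ k)

    degree≤∣C∣+freshDegree : ∀ C x → degree x ≤ ∣ C ∣ + freshDegree C x
    degree≤∣C∣+freshDegree C x = begin
      degree x                                          ≤⟨ ∑-mono-≤ (λ i → split (lookup C i) _) ⟩
      ∑[ i < M ] (χ (lookup C i) + χ (freshCover C i x)) ≡⟨ ∑-distrib-+ (λ i → χ (lookup C i)) _ ⟩
      ∑[ i < M ] χ (lookup C i) + freshDegree C x       ≡⟨ cong (_+ freshDegree C x) (∣p∣≡∑χ C) ⟨
      ∣ C ∣ + freshDegree C x                           ∎
      where
      open ≤-Reasoning
      split : ∀ b c → χ c ≤ χ b + χ (not b ∧ c)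
      split false c     = ≤-refl
      split true  false = z≤n
      split true  true  = ≤-refl

    excess≤freshDegree : ∀ {C} → ∣ C ∣ ≤ r → ∀ x → excess x ≤ freshDegree C x
    excess≤freshDegree {C} ∣C∣≤r x = ≤-trans (∸-monoʳ-≤ (degree x) ∣C∣≤r)
      (m≤n+o⇒m∸n≤o (degree x) ∣ C ∣ (degree≤∣C∣+freshDegree C x))

    moment-zero : ∀ C → moment C 0 ≡ ∣ bigcap C X ∣
    moment-zero C = trans (sum-cong-≗ (λ x → *-identityʳ (χ (inAll C x)))) (sym (∣p∣≡∑χ (bigcap C X)))

    moment-⊥ : ∀ k → moment ⊥ k ≡ ∑[ x < N ] (excess x ^ k)
    moment-⊥ k = sum-cong-≗ (λ x →
      trans (cong (λ b → χ b * excess x ^ k) (lookup-bigcap-⊥ X x)) (+-identityʳ (excess x ^ k)))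

    moment-insert : ∀ C k i →
      ∑[ x < N ] (χ (inAll C x) * (χ (freshCover C i x) * excess x ^ k)) ≡
      χ (not (lookup C i)) * moment (C [ i ]≔ true) k
    moment-insert C k i with lookup C i in Cᵢ
    ... | true  = trans (sum-cong-≗ (λ x → *-zeroʳ (χ (inAll C x)))) (trans (∑-const N 0) (*-zeroʳ N))
    ... | false = trans (sum-cong-≗ (λ x → begin
      χ (inAll C x) * (χ (lookup (X i) x) * excess x ^ k) ≡⟨ *-assoc (χ (inAll C x)) _ (excess x ^ k) ⟨
      χ (inAll C x) * χ (lookup (X i) x) * excess x ^ k   ≡⟨ cong (_* excess x ^ k)
                                                               (χ-∧ (inAll C x) (lookup (X i) x)) ⟨
      χ (inAll C x ∧ lookup (X i) x) * excess x ^ k       ≡⟨ cong (λ b → χ b * excess x ^ k)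
                                                               (lookup-bigcap-insert C X i x Cᵢ) ⟨
      χ (inAll (C [ i ]≔ true) x) * excess x ^ k          ∎)) (sym (+-identityʳ _))
      where open ≡-Reasoning

    moment-suc≤ : ∀ {C} k → ∣ C ∣ ≤ r →
      moment C (suc k) ≤ ∑[ i < M ] (χ (not (lookup C i)) * moment (C [ i ]≔ true) k)
    moment-suc≤ {C} k ∣C∣≤r = begin
      ∑[ x < N ] (χ (inAll C x) * (excess x * excess x ^ k))
        ≤⟨ ∑-mono-≤ (λ x → *-monoʳ-≤ (χ (inAll C x))
             (*-monoˡ-≤ (excess x ^ k) (excess≤freshDegree {C} ∣C∣≤r x))) ⟩
      ∑[ x < N ] (χ (inAll C x) * (freshDegree C x * excess x ^ k))
        ≡⟨ sum-cong-≗ (λ x → trans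
             (cong (χ (inAll C x) *_) (*-distribʳ-sum (excess x ^ k) (λ i → χ (freshCover C i x))))
             (*-distribˡ-sum (χ (inAll C x)) (λ i → χ (freshCover C i x) * excess x ^ k))) ⟩
      ∑[ x < N ] ∑[ i < M ] (χ (inAll C x) * (χ (freshCover C i x) * excess x ^ k))
        ≡⟨ ∑-comm (λ x i → χ (inAll C x) * (χ (freshCover C i x) * excess x ^ k)) ⟩
      ∑[ i < M ] ∑[ x < N ] (χ (inAll C x) * (χ (freshCover C i x) * excess x ^ k))
        ≡⟨ sum-cong-≗ (moment-insert C k) ⟩
      ∑[ i < M ] (χ (not (lookup C i)) * moment (C [ i ]≔ true) k) ∎
      where open ≤-Reasoning

    greedy : ∀ k (C : Subset M) → ∣ C ∣ + k ≡ r → r ≤ M →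
      ∃ λ C′ → ∣ C′ ∣ ≡ r × moment C k ≤ M ^ k * ∣ bigcap C′ X ∣
    greedy zero C ∣C∣+0≡r r≤M =
      C , trans (sym (+-identityʳ ∣ C ∣)) ∣C∣+0≡r ,
      ≤-reflexive (trans (moment-zero C) (sym (+-identityʳ ∣ bigcap C X ∣)))
    greedy (suc k) C ∣C∣+k≡r r≤M
      with pigeonhole (lookup C) (λ i → moment (C [ i ]≔ true) k) (∣p∣<n⇒∃∉ C ∣C∣<M)
      where
      ∣C∣<M : ∣ C ∣ < M
      ∣C∣<M = ≤-trans (m<m+n ∣ C ∣ z<s) (≤-trans (≤-reflexive ∣C∣+k≡r) r≤M)
    ... | i , Cᵢ , bound
      with greedy k (C [ i ]≔ true) ∣C∪i∣+k≡r r≤M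
      where
      ∣C∪i∣+k≡r : ∣ C [ i ]≔ true ∣ + k ≡ r
      ∣C∪i∣+k≡r = trans (cong (_+ k) (∣p[i]≔true∣≡1+∣p∣ C i Cᵢ)) (trans (sym (+-suc ∣ C ∣ k)) ∣C∣+k≡r)
    ...   | C′ , ∣C′∣≡r , bound′ = C′ , ∣C′∣≡r , (begin
      moment C (suc k)               ≤⟨ moment-suc≤ {C} k ∣C∣≤r ⟩
      ∑[ j < M ] (χ (not (lookup C j)) * moment (C [ j ]≔ true) k) ≤⟨ bound ⟩
      M * moment (C [ i ]≔ true) k   ≤⟨ *-monoʳ-≤ M bound′ ⟩
      M * (M ^ k * ∣ bigcap C′ X ∣)  ≡⟨ *-assoc M (M ^ k) ∣ bigcap C′ X ∣ ⟨
      M ^ suc k * ∣ bigcap C′ X ∣    ∎)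
      where
      open ≤-Reasoning
      ∣C∣≤r : ∣ C ∣ ≤ r
      ∣C∣≤r = ≤-trans (m≤m+n ∣ C ∣ (suc k)) (≤-reflexive ∣C∣+k≡r)

    greedy-from-⊥ : r ≤ M → ∃ λ C → ∣ C ∣ ≡ r × ∑[ x < N ] (excess x ^ r) ≤ M ^ r * ∣ bigcap C X ∣
    greedy-from-⊥ r≤M with greedy r ⊥ (cong (_+ r) (∣⊥∣≡0 M)) r≤M
    ... | C , ∣C∣≡r , bound = C , ∣C∣≡r , subst (_≤ M ^ r * ∣ bigcap C X ∣) (moment-⊥ r) bound

    ∑degree≡∑∣X∣ : ∑[ x < N ] degree x ≡ ∑[ i < M ] ∣ X i ∣
    ∑degree≡∑∣X∣ = trans (∑-comm (λ x i → χ (lookup (X i) x))) (sym (sum-cong-≗ (λ i → ∣p∣≡∑χ (X i))))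

    ∑excess-lower-bound : ∀ {p q} → (∀ i → p * N ≤ q * ∣ X i ∣) → 2 * q * r ≤ M * p →
      M * (p * N) ≤ 2 * q * ∑[ x < N ] excess x
    ∑excess-lower-bound {p} {q} dense 2qr≤Mp = +-cancelˡ-≤ T T (2 * q * S) (begin
      T + T                         ≡⟨ cong (T +_) (+-identityʳ T) ⟨
      2 * T                         ≤⟨ *-monoʳ-≤ 2 T≤q[Nr+S] ⟩
      2 * (q * (N * r + S))         ≡⟨ expand q N r S ⟩
      2 * q * r * N + 2 * q * S     ≤⟨ +-monoˡ-≤ (2 * q * S) (*-monoˡ-≤ N 2qr≤Mp) ⟩
      M * p * N + 2 * q * S         ≡⟨ cong (_+ 2 * q * S) (*-assoc M p N) ⟩
      T + 2 * q * S                 ∎)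
      where
      open ≤-Reasoning
      T = M * (p * N)
      S = ∑[ x < N ] excess x
      expand : ∀ q N r S → 2 * (q * (N * r + S)) ≡ 2 * q * r * N + 2 * q * S
      expand = solve-∀
      T≤q[Nr+S] : T ≤ q * (N * r + S)
      T≤q[Nr+S] = begin
        M * (p * N)                    ≡⟨ ∑-const M (p * N) ⟨
        ∑[ i < M ] (p * N)             ≤⟨ ∑-mono-≤ dense ⟩
        ∑[ i < M ] (q * ∣ X i ∣)       ≡⟨ *-distribˡ-sum q (λ i → ∣ X i ∣) ⟨
        q * ∑[ i < M ] ∣ X i ∣         ≡⟨ cong (q *_) ∑degree≡∑∣X∣ ⟨
        q * ∑[ x < N ] degree x        ≤⟨ *-monoʳ-≤ q (∑-mono-≤ (λ x → m≤n+m∸n (degree x) r)) ⟩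
        q * ∑[ x < N ] (r + excess x)  ≡⟨ cong (q *_) (∑-distrib-+ (λ _ → r) excess) ⟩
        q * (∑[ x < N ] r + S)         ≡⟨ cong (λ t → q * (t + S)) (∑-const N r) ⟩
        q * (N * r + S)                ∎

  dense-family-common-intersection : ∀ {M N p q} (X : Fin M → Subset N) r →
    .{{_ : NonZero M}} .{{_ : NonZero N}} .{{_ : NonZero p}} .{{_ : NonZero q}} →
    (∀ i → p * N ≤ q * ∣ X i ∣) → 2 * q * r ≤ M →
    ∃ λ C → ∣ C ∣ ≡ r × p ^ r * N ≤ (2 * q) ^ r * ∣ bigcap C X ∣
  dense-family-common-intersection {M} {N} {p} {q} X r dense 2qr≤M
    with greedy-from-⊥ (≤-trans (m≤n*m r (2 * q) {{m*n≢0 2 q}}) 2qr≤M)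
    where open Greedy X r
  ... | C , ∣C∣≡r , bound = C , ∣C∣≡r ,
    *-cancelˡ-≤ ((M * N) ^ r) {{m^n≢0 (M * N) r {{m*n≢0 M N}}}} (begin
      (M * N) ^ r * (p ^ r * N)           ≡⟨ cong (_* (p ^ r * N)) (*-^-distrib M N r) ⟩
      M ^ r * N ^ r * (p ^ r * N)         ≡⟨ regroup (M ^ r) (N ^ r) (p ^ r) N ⟩
      M ^ r * (p ^ r * N ^ r) * N         ≡⟨ cong (λ t → M ^ r * t * N) (*-^-distrib p N r) ⟨
      M ^ r * (p * N) ^ r * N             ≡⟨ cong (_* N) (*-^-distrib M (p * N) r) ⟨
      (M * (p * N)) ^ r * N               ≤⟨ *-monoˡ-≤ N (^-monoˡ-≤ r MpN≤2qS) ⟩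
      (2 * q * S) ^ r * N                 ≡⟨ cong (_* N) (*-^-distrib (2 * q) S r) ⟩
      (2 * q) ^ r * S ^ r * N             ≡⟨ *-assoc ((2 * q) ^ r) (S ^ r) N ⟩
      (2 * q) ^ r * (S ^ r * N)           ≤⟨ *-monoʳ-≤ ((2 * q) ^ r) (power-mean excess r) ⟩
      (2 * q) ^ r * (N ^ r * ∑[ x < N ] (excess x ^ r))
                                          ≤⟨ *-monoʳ-≤ ((2 * q) ^ r) (*-monoʳ-≤ (N ^ r) bound) ⟩
      (2 * q) ^ r * (N ^ r * (M ^ r * Y)) ≡⟨ regroup′ ((2 * q) ^ r) (N ^ r) (M ^ r) Y ⟩
      M ^ r * N ^ r * ((2 * q) ^ r * Y)   ≡⟨ cong (_* ((2 * q) ^ r * Y)) (*-^-distrib M N r) ⟨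
      (M * N) ^ r * ((2 * q) ^ r * Y)     ∎)
    where
    open Greedy X r
    open ≤-Reasoning
    S = ∑[ x < N ] excess x
    Y = ∣ bigcap C X ∣
    MpN≤2qS : M * (p * N) ≤ 2 * q * S
    MpN≤2qS = ∑excess-lower-bound {p} {q} dense (≤-trans 2qr≤M (m≤m*n M p))
    regroup : ∀ a b c d → a * b * (c * d) ≡ a * (c * b) * d
    regroup = solve-∀
    regroup′ : ∀ a b c d → a * (b * (c * d)) ≡ c * b * (a * d)
    regroup′ = solve-∀

  -- Powers of two and the constant δₛ

  n≤2^⌈log2⌉n : ∀ n (acc : Acc _<_ n) → n ≤ 2 ^ ⌈log2⌉ n acc
  n≤2^⌈log2⌉n zero          _        = z≤n
  n≤2^⌈log2⌉n (suc zero)    _        = s≤s z≤n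
  n≤2^⌈log2⌉n (suc (suc n)) (acc rs) = begin
    2 + n                      ≡⟨ cong (2 +_) (⌊n/2⌋+⌈n/2⌉≡n n) ⟨
    2 + (⌊ n /2⌋ + ⌈ n /2⌉)    ≤⟨ +-monoʳ-≤ 2 (+-monoˡ-≤ ⌈ n /2⌉ (⌊n/2⌋≤⌈n/2⌉ n)) ⟩
    2 + (⌈ n /2⌉ + ⌈ n /2⌉)    ≡⟨ double-suc ⌈ n /2⌉ ⟩
    2 * suc ⌈ n /2⌉            ≤⟨ *-monoʳ-≤ 2 (n≤2^⌈log2⌉n (suc ⌈ n /2⌉) (rs (⌈n/2⌉<n n))) ⟩
    2 * 2 ^ ⌈log2⌉ (suc ⌈ n /2⌉) (rs (⌈n/2⌉<n n)) ∎
    where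
    open ≤-Reasoning
    double-suc : ∀ h → 2 + (h + h) ≡ 2 * suc h
    double-suc = solve-∀

  n≤2^⌈log₂n⌉ : ∀ n → n ≤ 2 ^ ⌈log₂ n ⌉
  n≤2^⌈log₂n⌉ n = n≤2^⌈log2⌉n n (<-wellFounded n)

  4*2^r≤[r+r]*4^m : ∀ {r m} → 1 ≤ r → r ≤ m → 4 * 2 ^ r ≤ (r + r) * 4 ^ m
  4*2^r≤[r+r]*4^m {r} {m} 1≤r r≤m = begin
    4 * 2 ^ r                 ≡⟨ *-assoc 2 2 (2 ^ r) ⟩
    2 * (2 * 2 ^ r)           ≤⟨ *-mono-≤ (+-mono-≤ 1≤r 1≤r) (*-monoˡ-≤ (2 ^ r) (^-monoʳ-≤ 2 1≤r)) ⟩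
    (r + r) * (2 ^ r * 2 ^ r) ≡⟨ cong ((r + r) *_) (*-^-distrib 2 2 r) ⟨
    (r + r) * 4 ^ r           ≤⟨ *-monoʳ-≤ (r + r) (^-monoʳ-≤ 4 r≤m) ⟩
    (r + r) * 4 ^ m           ∎
    where open ≤-Reasoning

  -- With δ = p / q this says: if (δ/2)^r N ≤ Y and r ≤ m then 4 (δ/4)^m N ≤ 2r Y.
  tower-bound : ∀ {p q r m N Y} → p ≤ q → 1 ≤ r → r ≤ m →
    p ^ r * N ≤ (2 * q) ^ r * Y → 4 * p ^ m * N ≤ (r + r) * Y * (4 * q) ^ m
  tower-bound {p} {q} {r} {m} {N} {Y} p≤q 1≤r r≤m bound with m≤n⇒∃[o]m+o≡n r≤m
  ... | t , refl = begin
    4 * p ^ (r + t) * N                       ≡⟨ cong (λ u → 4 * u * N) (^-distribˡ-+-* p r t) ⟩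
    4 * (p ^ r * p ^ t) * N                   ≡⟨ regroup (p ^ r) (p ^ t) N ⟩
    4 * p ^ t * (p ^ r * N)                   ≤⟨ *-mono-≤ (*-monoʳ-≤ 4 (^-monoˡ-≤ t p≤q)) bound ⟩
    4 * q ^ t * ((2 * q) ^ r * Y)             ≡⟨ cong (λ u → 4 * q ^ t * (u * Y)) (*-^-distrib 2 q r) ⟩
    4 * q ^ t * (2 ^ r * q ^ r * Y)           ≡⟨ regroup′ (2 ^ r) (q ^ r) (q ^ t) Y ⟩
    4 * 2 ^ r * (q ^ r * q ^ t) * Y           ≤⟨ *-monoˡ-≤ Y (*-monoˡ-≤ (q ^ r * q ^ t)
                                                   (4*2^r≤[r+r]*4^m 1≤r r≤m)) ⟩
    (r + r) * 4 ^ (r + t) * (q ^ r * q ^ t) * Y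
                          ≡⟨ cong (λ u → (r + r) * 4 ^ (r + t) * u * Y) (^-distribˡ-+-* q r t) ⟨
    (r + r) * 4 ^ (r + t) * q ^ (r + t) * Y   ≡⟨ regroup″ (r + r) (4 ^ (r + t)) (q ^ (r + t)) Y ⟩
    (r + r) * Y * (4 ^ (r + t) * q ^ (r + t)) ≡⟨ cong ((r + r) * Y *_) (*-^-distrib 4 q (r + t)) ⟨
    (r + r) * Y * (4 * q) ^ (r + t)           ∎
    where
    open ≤-Reasoning
    regroup : ∀ a b n → 4 * (a * b) * n ≡ 4 * b * (a * n)
    regroup = solve-∀
    regroup′ : ∀ a b c y → 4 * c * (a * b * y) ≡ 4 * a * (b * c) * y
    regroup′ = solve-∀
    regroup″ : ∀ a b c y → a * b * c * y ≡ a * y * (b * c)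
    regroup″ = solve-∀

module Rationals where
  open import Data.Empty using (⊥)
  open import Data.Fin using (Fin)
  open import Data.Fin.Subset using (Subset; ∣_∣)
  open import Data.Integer as ℤ using (+_; +≤+)
  open import Data.Integer.Properties using (pos-*; drop‿+≤+)
  open import Data.Nat using (ℕ; zero; suc; _+_; _*_; _^_; _≤_; NonZero; >-nonZero)
  open import Data.Nat.Coprimality using (Coprime)
  open import Data.Nat.Logarithm using (⌈log₂_⌉)
  open import Data.Nat.Properties
    using (m*n≢0; m^n≢0; ^-distribˡ-+-*; +-identityʳ; *-identityʳ; *-comm; ≤-trans; m≤n*m)
  open import Data.Nat.Tactic.RingSolver using (solve-∀)
  open import Data.Product using (Σ; _×_; _,_)
  open import Data.Rational as ℚ using (ℚ; mkℚ; toℚᵘ; 1ℚ)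
  open import Data.Rational.Properties using (toℚᵘ-fromℚᵘ; toℚᵘ-homo-*; toℚᵘ-mono-≤; toℚᵘ-cancel-≤)
  open import Data.Rational.Unnormalised as ℚᵘ using (mkℚᵘ; *≤*; *≡*; _≃_)
  open import Data.Rational.Unnormalised.Properties
    using (≃-refl; ≃-sym; ≃-trans; ≃-reflexive; *-cong; ≤-respˡ-≃; ≤-respʳ-≃)
  open import Relation.Binary.PropositionalEquality
    using (_≡_; sym; trans; cong; subst₂; module ≡-Reasoning)
  open Counting using (dense-family-common-intersection; tower-bound; n≤2^⌈log₂n⌉)

  -- x is a / b: x equals a/b for naturals a, b, compared in ℚᵘ so that a/b need not be reduced.
  -- It is empty for b = 0, so a proof of it carries b ≢ 0 and the lemmas need no NonZero b.
  infix 4 _is_/_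
  _is_/_ : ℚ → ℕ → ℕ → Set
  x is a / zero  = ⊥
  x is a / suc b = toℚᵘ x ≃ mkℚᵘ (+ a) b

  /-is : ∀ a b .{{_ : NonZero b}} → + a ℚ./ b is a / b
  /-is a (suc b) = toℚᵘ-fromℚᵘ (mkℚᵘ (+ a) b)

  mkℚ-is : ∀ a b .(c : Coprime a (suc b)) → mkℚ (+ a) b c is a / suc b
  mkℚ-is a b c = ≃-refl

  *-is : ∀ {x y a b c d} → x is a / b → y is c / d → x ℚ.* y is a * c / (b * d)
  *-is {b = zero} ()
  *-is {b = suc _} {d = zero} _ ()
  *-is {x} {y} {a} {suc b} {c} {suc d} x-is y-is = ≃-trans (toℚᵘ-homo-* x y)
    (≃-trans (*-cong x-is y-is) (≃-reflexive (cong (λ n → mkℚᵘ n (d + b * suc d)) (sym (pos-* a c)))))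

  is-resp : ∀ {x a b c d} {{_ : NonZero d}} → x is a / b → a * d ≡ c * b → x is c / d
  is-resp {b = zero} ()
  is-resp {b = suc _} {d = zero} {{()}}
  is-resp {a = a} {suc b} {c} {suc d} x-is ad≡cb =
    ≃-trans x-is (*≡* (trans (sym (pos-* a (suc d))) (trans (cong +_ ad≡cb) (pos-* c (suc b)))))

  is-≤ : ∀ {x y a b c d} → x is a / b → y is c / d → a * d ≤ c * b → x ℚ.≤ y
  is-≤ {b = zero} ()
  is-≤ {b = suc _} {d = zero} _ ()
  is-≤ {a = a} {suc b} {c} {suc d} x-is y-is ad≤cb = toℚᵘ-cancel-≤
    (≤-respˡ-≃ (≃-sym x-is) (≤-respʳ-≃ (≃-sym y-is)
      (*≤* (subst₂ ℤ._≤_ (pos-* a (suc d)) (pos-* c (suc b)) (+≤+ ad≤cb)))))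

  ≤-is : ∀ {x y a b c d} → x is a / b → y is c / d → x ℚ.≤ y → a * d ≤ c * b
  ≤-is {b = zero} ()
  ≤-is {b = suc _} {d = zero} _ ()
  ≤-is {a = a} {suc b} {c} {suc d} x-is y-is x≤y
    with ≤-respˡ-≃ x-is (≤-respʳ-≃ y-is (toℚᵘ-mono-≤ x≤y))
  ... | *≤* ad≤cb = drop‿+≤+ (subst₂ ℤ._≤_ (sym (pos-* a (suc d))) (sym (pos-* c (suc b))) ad≤cb)

  4q^n≢0 : ∀ q n .{{_ : NonZero q}} → NonZero ((4 * q) ^ n)
  4q^n≢0 q n = m^n≢0 (4 * q) n {{m*n≢0 4 q}}

  δseq-is : ∀ {δ p q} .{{_ : NonZero q}} → δ is p / q →
    ∀ k → δseq δ k is 4 * p ^ 2 ^ k / (4 * q) ^ 2 ^ k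
  δseq-is {p = p} {q} δ-is zero = is-resp {{4q^n≢0 q 1}} δ-is (rescale p q)
    where
    rescale : ∀ p q → p * ((4 * q) * 1) ≡ 4 * (p * 1) * q
    rescale = solve-∀
  δseq-is {δ} {p} {q} δ-is (suc k) =
    is-resp {{4q^n≢0 q (2 ^ suc k)}} (*-is (*-is (δseq-is δ-is k) (δseq-is δ-is k)) (/-is 1 4)) (begin
      4 * p ^ m * (4 * p ^ m) * 1 * D ^ (2 * m)     ≡⟨ cong (4 * p ^ m * (4 * p ^ m) * 1 *_) (^-double D m) ⟩
      4 * p ^ m * (4 * p ^ m) * 1 * (D ^ m * D ^ m) ≡⟨ regroup (p ^ m) (D ^ m) ⟩
      4 * (p ^ m * p ^ m) * (D ^ m * D ^ m * 4)     ≡⟨ cong (λ t → 4 * t * (D ^ m * D ^ m * 4)) (^-double p m) ⟨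
      4 * p ^ (2 * m) * (D ^ m * D ^ m * 4)         ∎)
    where
    open ≡-Reasoning
    m = 2 ^ k
    D = 4 * q
    ^-double : ∀ x n → x ^ (2 * n) ≡ x ^ n * x ^ n
    ^-double x n = trans (cong (λ t → x ^ (n + t)) (+-identityʳ n)) (^-distribˡ-+-* x n n)
    regroup : ∀ a d → 4 * a * (4 * a) * 1 * (d * d) ≡ 4 * (a * a) * (d * d * 4)
    regroup = solve-∀

  module _ {δ : ℚ} {p q : ℕ} .{{_ : NonZero p}} .{{_ : NonZero q}} (δ-is : δ is p / q) where

    density-from-ℚ : ∀ {N n} → δ ℚ.* ℕ→ℚ N ℚ.≤ ℕ→ℚ n → p * N ≤ q * n
    density-from-ℚ {N} {n} δN≤n =
      subst₂ _≤_ (*-identityʳ (p * N)) (trans (cong (n *_) (*-identityʳ q)) (*-comm n q))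
        (≤-is (*-is δ-is (/-is N 1)) (/-is n 1) δN≤n)

    δ≤1⇒p≤q : δ ℚ.≤ 1ℚ → p ≤ q
    δ≤1⇒p≤q δ≤1 = subst₂ _≤_ (*-identityʳ p) (+-identityʳ q) (≤-is δ-is (/-is 1 1) δ≤1)

    δseq-bound-from-ℕ : ∀ {N Y} k n → 4 * p ^ 2 ^ k * N ≤ n * Y * (4 * q) ^ 2 ^ k →
      δseq δ k ℚ.* ℕ→ℚ N ℚ.≤ ℕ→ℚ n ℚ.* ℕ→ℚ Y
    δseq-bound-from-ℕ {N} {Y} k n bound =
      is-≤ (*-is (δseq-is δ-is k) (/-is N 1)) (*-is (/-is n 1) (/-is Y 1))
        (subst₂ _≤_ (sym (*-identityʳ (4 * p ^ 2 ^ k * N)))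
                    (cong (n * Y *_) (sym (*-identityʳ ((4 * q) ^ 2 ^ k)))) bound)

    dense-family-δseq : δ ℚ.≤ 1ℚ → ∀ r → 1 ≤ r → ∀ N → 2 * q * r ≤ N → (X : Fin N → Subset N) →
      (∀ i → δ ℚ.* ℕ→ℚ N ℚ.≤ ℕ→ℚ ∣ X i ∣) →
      Σ (Subset N) λ I → ∣ I ∣ ≡ r ×
        δseq δ ⌈log₂ r ⌉ ℚ.* ℕ→ℚ N ℚ.≤ ℕ→ℚ (r + r) ℚ.* ℕ→ℚ ∣ bigcap I X ∣
    dense-family-δseq δ≤1 r 1≤r N N₀≤N X dense
      with dense-family-common-intersection X r {{N≢0}} {{N≢0}} (λ i → density-from-ℚ (dense i)) N₀≤N
      where
      N≢0 : NonZero N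
      N≢0 = >-nonZero (≤-trans 1≤r (≤-trans (m≤n*m r (2 * q) {{m*n≢0 2 q}}) N₀≤N))
    ... | C , ∣C∣≡r , bound = C , ∣C∣≡r ,
      δseq-bound-from-ℕ ⌈log₂ r ⌉ (r + r) (tower-bound (δ≤1⇒p≤q δ≤1) 1≤r (n≤2^⌈log₂n⌉ r) bound)

open import Data.Nat using (ℕ; _≥_; _+_; suc)
open import Data.Nat.Logarithm using (⌈log₂_⌉)
open import Data.Rational using (ℚ; _≤_; _<_; _*_; 0ℚ; 1ℚ)
open import Data.Fin using (Fin)
open import Data.Fin.Subset using (Subset; ∣_∣)
open import Data.Product using (Σ; _×_; ∃)
open import Relation.Binary.PropositionalEquality using (_≡_)
open import Data.Integer using (+_; -[1+_]; +<+)
open import Data.Product using (_,_)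
open import Data.Rational using (mkℚ; *<*)
open Rationals using (mkℚ-is; dense-family-δseq)

lemma2 : (δ : ℚ) → 0ℚ < δ → δ ≤ 1ℚ → (r : ℕ) → r ≥ 1 →
    ∃ λ (N₀ : ℕ) → (N : ℕ) → N ≥ N₀ → (X : Fin N → Subset N) →
      ((i : Fin N) → δ * ℕ→ℚ N ≤ ℕ→ℚ ∣ X i ∣) →
      Σ (Subset N) λ I → (∣ I ∣ ≡ r) ×
        (δseq δ ⌈log₂ r ⌉ * ℕ→ℚ N ≤ ℕ→ℚ (r + r) * ℕ→ℚ ∣ bigcap I X ∣)
lemma2 (mkℚ (+ 0) _ _) (*<* (+<+ ())) _ _ _
lemma2 (mkℚ -[1+ _ ] _ _) (*<* ()) _ _ _
lemma2 (mkℚ (+ suc p-1) q-1 c) _ δ≤1 r 1≤r =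
  _ , dense-family-δseq (mkℚ-is (suc p-1) q-1 c) δ≤1 r 1≤r
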